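{- There is a formula $\mathsf H(x,y)$ in the language of $\mathsf{SB}$ such that $\mathsf{SB}$ proves that $\mathsf H$ is a bijection between $\mathsf A/\mathsf E_{\mathsf A}$ and $\mathsf B/\mathsf E_{\mathsf B}$, i.e. $\mathsf{SB}$ proves: $x\mathrel{\mathsf H}y$ implies $\mathsf A x$ and $\mathsf B y$; $\mathsf H$ respects $\mathsf E_{\mathsf A}$ and $\mathsf E_{\mathsf B}$; every element of $\mathsf A$ is $\mathsf H$-related to some element; $\mathsf H$ is functional and injective modulo $\mathsf E_{\mathsf B}$ and $\mathsf E_{\mathsf A}$ respectively; and every element of $\mathsf B$ is in the range of $\mathsf H$.
   Context: The theory $\mathsf{ac}$ (adjunctive class theory) is two-sorted, with a sort of objects and a sort of classes, identity on each sort, and a membership relation $\in$ between objects and classes, with axioms: there is a class with no members; for every class $Y$ and object $y$ there is a class $X$ with $\forall x\,(x\in X\leftrightarrow (x\in Y\vee x=y))$; classes with the same members are equal. The theory $\mathsf{SB}$ is $\mathsf{ac}$ extended with unary predicates $\mathsf A,\mathsf B$ on objects and binary predicates $\mathsf E_{\mathsf A},\mathsf E_{\mathsf B},\mathsf F,\mathsf G$ on objects, with axioms stating: $\mathsf E_{\mathsf A}$ is an equivalence relation on $\{x\mid \mathsf A x\}$; $\mathsf E_{\mathsf B}$ is an equivalence relation on $\{y\mid\mathsf B y\}$; $\mathsf F$ is an injection from $\mathsf A/\mathsf E_{\mathsf A}$ to $\mathsf B/\mathsf E_{\mathsf B}$; $\mathsf G$ is an injection from $\mathsf B/\mathsf E_{\mathsf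 B}$ to $\mathsf A/\mathsf E_{\mathsf A}$. Here "$\mathsf F$ is an injection from $\mathsf A/\mathsf E_{\mathsf A}$ to $\mathsf B/\mathsf E_{\mathsf B}$" means: $x\mathrel{\mathsf F}y$ implies $\mathsf A x$ and $\mathsf B y$; if $x\,\mathsf E_{\mathsf A}\,x'\mathrel{\mathsf F}y'\,\mathsf E_{\mathsf B}\,y$ then $x\mathrel{\mathsf F}y$; every $x\in\mathsf A$ has some $y$ with $x\mathrel{\mathsf F}y$; $x\mathrel{\mathsf F}y$ and $x\mathrel{\mathsf F}y'$ imply $y\,\mathsf E_{\mathsf B}\,y'$; $x\mathrel{\mathsf F}y$ and $x'\mathrel{\mathsf F}y$ imply $x\,\mathsf E_{\mathsf A}\,x'$. Similarly for $\mathsf G$ with the roles of $\mathsf A,\mathsf B$ swapped. -}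

module Defs where

open import Data.Nat using (ℕ; zero; suc)
open import Data.Fin using (Fin; zero; suc; #_)
open import Data.List using (List; []; _∷_; map)
open import Data.List.Membership.Propositional using (_∈_)
open import Data.Product using (_×_)

-- Formula m n : formulas whose free object variables are among Fin m
-- and whose free class variables are among Fin n (de Bruijn indices,
-- index 0 = innermost binder of that sort).  The language has no
-- function symbols, so terms are variables.

infixr 5 _⇒_
infix 7 _≐o_ _≐c_ _∈'_

data Formula (m n : ℕ) : Set where
  ⊥'   : Formula m n
  _⇒_  : Formula m n → Formula m n → Formula m n
  ∀o   : Formula (suc m) n → Formula m n
  ∀c   : Formula m (suc n) → Formula m n
  _≐o_ : Fin m → Fin m → Formula m n
  _≐c_ : Fin n → Fin n → Formula m n
  _∈'_ : Fin m → Fin n → Formula m n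
  A' B' : Fin m → Formula m n
  EA EB F G : Fin m → Fin m → Formula m n

¬' : ∀ {m n} → Formula m n → Formula m n
¬' φ = φ ⇒ ⊥'

infixr 4 _∨'_
infixr 6 _∧'_
infix 3 _⇔'_

_∨'_ : ∀ {m n} → Formula m n → Formula m n → Formula m n
φ ∨' ψ = ¬' φ ⇒ ψ

_∧'_ : ∀ {m n} → Formula m n → Formula m n → Formula m n
φ ∧' ψ = ¬' (φ ⇒ ¬' ψ)

_⇔'_ : ∀ {m n} → Formula m n → Formula m n → Formula m n
φ ⇔' ψ = (φ ⇒ ψ) ∧' (ψ ⇒ φ)

∃o : ∀ {m n} → Formula (suc m) n → Formula m n
∃o φ = ¬' (∀o (¬' φ))

∃c : ∀ {m n} → Formula m (suc n) → Formula m n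
∃c φ = ¬' (∀c (¬' φ))

ext : ∀ {m m'} → (Fin m → Fin m') → Fin (suc m) → Fin (suc m')
ext ρ zero    = zero
ext ρ (suc i) = suc (ρ i)

rename : ∀ {m n m' n'} → (Fin m → Fin m') → (Fin n → Fin n') →
         Formula m n → Formula m' n'
rename ρ σ ⊥'        = ⊥'
rename ρ σ (φ ⇒ ψ)   = rename ρ σ φ ⇒ rename ρ σ ψ
rename ρ σ (∀o φ)    = ∀o (rename (ext ρ) σ φ)
rename ρ σ (∀c φ)    = ∀c (rename ρ (ext σ) φ)
rename ρ σ (i ≐o j)  = ρ i ≐o ρ j
rename ρ σ (X ≐c Y)  = σ X ≐c σ Y
rename ρ σ (i ∈' X)  = ρ i ∈' σ X
rename ρ σ (A' i)    = A' (ρ i)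
rename ρ σ (B' i)    = B' (ρ i)
rename ρ σ (EA i j)  = EA (ρ i) (ρ j)
rename ρ σ (EB i j)  = EB (ρ i) (ρ j)
rename ρ σ (F i j)   = F (ρ i) (ρ j)
rename ρ σ (G i j)   = G (ρ i) (ρ j)

idF : ∀ {k} → Fin k → Fin k
idF i = i

inst : ∀ {k} → Fin k → Fin (suc k) → Fin k
inst i zero    = i
inst i (suc j) = j

wkO : ∀ {m n} → Formula m n → Formula (suc m) n
wkO = rename suc idF

wkC : ∀ {m n} → Formula m n → Formula m (suc n)
wkC = rename idF suc

substO : ∀ {m n} → Fin m → Formula (suc m) n → Formula m n
substO i = rename (inst i) idF

substC : ∀ {m n} → Fin n → Formula m (suc n) → Formula m n
substC X = rename idF (inst X)

fromClosed : ∀ {m n} → Formula 0 0 → Formula m n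
fromClosed = rename (λ ()) (λ ())

Theory : Set₁
Theory = Formula 0 0 → Set

infix 2 _∣_⊢_

data _∣_⊢_ (T : Theory) {m n : ℕ} : List (Formula m n) → Formula m n → Set where
  ax    : ∀ {Γ φ} → T φ → T ∣ Γ ⊢ fromClosed φ
  hyp   : ∀ {Γ φ} → φ ∈ Γ → T ∣ Γ ⊢ φ
  ⇒I    : ∀ {Γ φ ψ} → T ∣ φ ∷ Γ ⊢ ψ → T ∣ Γ ⊢ φ ⇒ ψ
  ⇒E    : ∀ {Γ φ ψ} → T ∣ Γ ⊢ φ ⇒ ψ → T ∣ Γ ⊢ φ → T ∣ Γ ⊢ ψ
  raa   : ∀ {Γ φ} → T ∣ ¬' φ ∷ Γ ⊢ ⊥' → T ∣ Γ ⊢ φ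
  ∀oI   : ∀ {Γ φ} → T ∣ map wkO Γ ⊢ φ → T ∣ Γ ⊢ ∀o φ
  ∀oE   : ∀ {Γ φ} → T ∣ Γ ⊢ ∀o φ → (i : Fin m) → T ∣ Γ ⊢ substO i φ
  ∀cI   : ∀ {Γ φ} → T ∣ map wkC Γ ⊢ φ → T ∣ Γ ⊢ ∀c φ
  ∀cE   : ∀ {Γ φ} → T ∣ Γ ⊢ ∀c φ → (X : Fin n) → T ∣ Γ ⊢ substC X φ
  reflO : ∀ {Γ} (i : Fin m) → T ∣ Γ ⊢ i ≐o i
  eqO   : ∀ {Γ i j} (φ : Formula (suc m) n) →
          T ∣ Γ ⊢ i ≐o j → T ∣ Γ ⊢ substO i φ → T ∣ Γ ⊢ substO j φ
  reflC : ∀ {Γ} (X : Fin n) → T ∣ Γ ⊢ X ≐c X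
  eqC   : ∀ {Γ X Y} (φ : Formula m (suc n)) →
          T ∣ Γ ⊢ X ≐c Y → T ∣ Γ ⊢ substC X φ → T ∣ Γ ⊢ substC Y φ

_⊢_ : Theory → Formula 0 0 → Set
T ⊢ φ = T ∣ [] ⊢ φ

Rel₂ : Set
Rel₂ = ∀ {m n} → Fin m → Fin m → Formula m n

Pred₁ : Set
Pred₁ = ∀ {m n} → Fin m → Formula m n

data EquivAx (P : Pred₁) (E : Rel₂) : Formula 0 0 → Set where
  field⊆ : EquivAx P E (∀o (∀o (E (# 1) (# 0) ⇒ P (# 1) ∧' P (# 0))))
  refl'  : EquivAx P E (∀o (P (# 0) ⇒ E (# 0) (# 0)))
  sym'   : EquivAx P E (∀o (∀o (E (# 1) (# 0) ⇒ E (# 0) (# 1))))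
  trans' : EquivAx P E (∀o (∀o (∀o (E (# 2) (# 1) ∧' E (# 1) (# 0) ⇒ E (# 2) (# 0)))))

data InjAx (P Q : Pred₁) (EP EQ R : Rel₂) : Formula 0 0 → Set where
  dom     : InjAx P Q EP EQ R (∀o (∀o (R (# 1) (# 0) ⇒ P (# 1) ∧' Q (# 0))))
  resp    : InjAx P Q EP EQ R
              -- x EP x' R y' EQ y  ⇒  x R y ; x=#3, x'=#2, y'=#1, y=#0
              (∀o (∀o (∀o (∀o (EP (# 3) (# 2) ∧' R (# 2) (# 1) ∧' EQ (# 1) (# 0)
                                ⇒ R (# 3) (# 0))))))
  total   : InjAx P Q EP EQ R (∀o (P (# 0) ⇒ ∃o (R (# 1) (# 0))))
  func    : InjAx P Q EP EQ R
              -- x R y ∧ x R y' ⇒ y EQ y' ; x=#2, y=#1, y'=#0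
              (∀o (∀o (∀o (R (# 2) (# 1) ∧' R (# 2) (# 0) ⇒ EQ (# 1) (# 0)))))
  inj     : InjAx P Q EP EQ R
              -- x R y ∧ x' R y ⇒ x EP x' ; x=#2, x'=#1, y=#0
              (∀o (∀o (∀o (R (# 2) (# 0) ∧' R (# 1) (# 0) ⇒ EP (# 2) (# 1)))))

data BijAx (P Q : Pred₁) (EP EQ R : Rel₂) : Formula 0 0 → Set where
  injection : ∀ {φ} → InjAx P Q EP EQ R φ → BijAx P Q EP EQ R φ
  surj      : BijAx P Q EP EQ R (∀o (Q (# 0) ⇒ ∃o (R (# 0) (# 1))))

data acAx : Formula 0 0 → Set where
  empty  : acAx (∃c (∀o (¬' (# 0 ∈' # 0))))
  -- ∀Y ∀y ∃X ∀x (x∈X ↔ (x∈Y ∨ x=y)); objects: x=#0, y=#1; classes: X=#0, Y=#1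
  adjunction : acAx (∀c (∀o (∃c (∀o
                 ((# 0 ∈' # 0) ⇔' ((# 0 ∈' # 1) ∨' (# 0 ≐o # 1)))))))
  extensionality : acAx (∀c (∀c (∀o ((# 0 ∈' # 0) ⇔' (# 0 ∈' # 1)) ⇒ (# 0 ≐c # 1))))

Aᵖ Bᵖ : Pred₁
Aᵖ i = A' i
Bᵖ i = B' i

EAʳ EBʳ Fʳ Gʳ : Rel₂
EAʳ i j = EA i j
EBʳ i j = EB i j
Fʳ i j = F i j
Gʳ i j = G i j

data SBAx : Formula 0 0 → Set where
  ac    : ∀ {φ} → acAx φ → SBAx φ
  EAeq  : ∀ {φ} → EquivAx Aᵖ EAʳ φ → SBAx φ
  EBeq  : ∀ {φ} → EquivAx Bᵖ EBʳ φ → SBAx φ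
  Finj  : ∀ {φ} → InjAx Aᵖ Bᵖ EAʳ EBʳ Fʳ φ → SBAx φ
  Ginj  : ∀ {φ} → InjAx Bᵖ Aᵖ EBʳ EAʳ Gʳ φ → SBAx φ

SB : Theory
SB = SBAx

-- A formula H(x,y) with exactly the free object variables x (= index 0)
-- and y (= index 1) and no free class variables, used as a relation.

pair : ∀ {m} → Fin m → Fin m → Fin 2 → Fin m
pair i j zero       = i
pair i j (suc zero) = j

asRel : Formula 2 0 → Rel₂
asRel H i j = rename (pair i j) (λ ()) H

-- Classically, the Schröder–Bernstein bijection sends x along F when the chain
-- of ancestors of x (alternately G- and F-preimages) stops in A, and along G⁻¹
-- otherwise. Here "stops in A" is replaced by a definable notion: x is anchored
-- if some classes XA, XB contain x up to EA and are closed under ancestors, i.e.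
-- every member of XB has an F-preimage in XA and every member of XA in the range
-- of G has a G-preimage in XB. Take H x y := (F x y ∧ x anchored) ∨ (G y x ∧ x
-- not anchored). Elements outside the range of G are anchored by ({x}, ∅), so H
-- is total; anchoredness passes from x to G(F x) by adjoining one element to
-- each class, so H is injective; and if a G-image of y is anchored by (XA, XB),
-- then so is some F-preimage of y in XA, so H is surjective. Besides the axioms
-- on E_A, E_B, F and G, only the empty class and adjunction are used.

{-# OPTIONS --safe #-}
module Submission where

open import Defs
open import Data.Nat using (ℕ; zero; suc)
open import Data.Fin using (Fin; zero; suc)
open import Data.List using (List; _∷_; map)
open import Data.List.Properties using (map-∘; map-cong)
open import Data.List.Relation.Binary.Subset.Propositional using (_⊆_)
open import Data.List.Relation.Binary.Subset.Propositional.Properties using (∷⁺ʳ; map⁺)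
open import Data.List.Membership.Propositional.Properties using (∈-map⁺)
open import Data.List.Relation.Unary.Any using (here; there)
open import Data.Product using (Σ; _,_)
open import Function using (_∘_)
open import Relation.Binary.PropositionalEquality
  using (_≡_; _≗_; refl; sym; trans; cong; cong₂; subst)

private variable
  T : Theory
  m n m' n' m'' n'' k k' l l' : ℕ
  Γ Δ : List (Formula m n)
  φ ψ χ : Formula m n

ext-cong : {ρ ρ' : Fin m → Fin m'} → ρ ≗ ρ' → ext ρ ≗ ext ρ'
ext-cong e zero    = refl
ext-cong e (suc i) = cong suc (e i)

ext-∘ : (ρ₂ : Fin m' → Fin m'') (ρ₁ : Fin m → Fin m') → ext ρ₂ ∘ ext ρ₁ ≗ ext (ρ₂ ∘ ρ₁)
ext-∘ ρ₂ ρ₁ zero    = refl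
ext-∘ ρ₂ ρ₁ (suc i) = refl

ext-id : {ρ : Fin m → Fin m} → ρ ≗ idF → ext ρ ≗ idF
ext-id e zero    = refl
ext-id e (suc i) = cong suc (e i)

rename-cong : {ρ ρ' : Fin m → Fin m'} {σ σ' : Fin n → Fin n'} →
              ρ ≗ ρ' → σ ≗ σ' → rename ρ σ ≗ rename ρ' σ'
rename-cong e f ⊥'       = refl
rename-cong e f (φ ⇒ ψ)  = cong₂ _⇒_ (rename-cong e f φ) (rename-cong e f ψ)
rename-cong e f (∀o φ)   = cong ∀o (rename-cong (ext-cong e) f φ)
rename-cong e f (∀c φ)   = cong ∀c (rename-cong e (ext-cong f) φ)
rename-cong e f (i ≐o j) = cong₂ _≐o_ (e i) (e j)
rename-cong e f (X ≐c Y) = cong₂ _≐c_ (f X) (f Y)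
rename-cong e f (i ∈' X) = cong₂ _∈'_ (e i) (f X)
rename-cong e f (A' i)   = cong A' (e i)
rename-cong e f (B' i)   = cong B' (e i)
rename-cong e f (EA i j) = cong₂ EA (e i) (e j)
rename-cong e f (EB i j) = cong₂ EB (e i) (e j)
rename-cong e f (F i j)  = cong₂ F (e i) (e j)
rename-cong e f (G i j)  = cong₂ G (e i) (e j)

rename-∘ : (ρ₂ : Fin m' → Fin m'') (σ₂ : Fin n' → Fin n'')
           (ρ₁ : Fin m → Fin m') (σ₁ : Fin n → Fin n') →
           rename ρ₂ σ₂ ∘ rename ρ₁ σ₁ ≗ rename (ρ₂ ∘ ρ₁) (σ₂ ∘ σ₁)
rename-∘ ρ₂ σ₂ ρ₁ σ₁ ⊥'       = refl
rename-∘ ρ₂ σ₂ ρ₁ σ₁ (φ ⇒ ψ)  = cong₂ _⇒_ (rename-∘ ρ₂ σ₂ ρ₁ σ₁ φ) (rename-∘ ρ₂ σ₂ ρ₁ σ₁ ψ)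
rename-∘ ρ₂ σ₂ ρ₁ σ₁ (∀o φ)   = cong ∀o (trans (rename-∘ (ext ρ₂) σ₂ (ext ρ₁) σ₁ φ)
                                               (rename-cong (ext-∘ ρ₂ ρ₁) (λ _ → refl) φ))
rename-∘ ρ₂ σ₂ ρ₁ σ₁ (∀c φ)   = cong ∀c (trans (rename-∘ ρ₂ (ext σ₂) ρ₁ (ext σ₁) φ)
                                               (rename-cong (λ _ → refl) (ext-∘ σ₂ σ₁) φ))
rename-∘ ρ₂ σ₂ ρ₁ σ₁ (i ≐o j) = refl
rename-∘ ρ₂ σ₂ ρ₁ σ₁ (X ≐c Y) = refl
rename-∘ ρ₂ σ₂ ρ₁ σ₁ (i ∈' X) = refl
rename-∘ ρ₂ σ₂ ρ₁ σ₁ (A' i)   = refl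
rename-∘ ρ₂ σ₂ ρ₁ σ₁ (B' i)   = refl
rename-∘ ρ₂ σ₂ ρ₁ σ₁ (EA i j) = refl
rename-∘ ρ₂ σ₂ ρ₁ σ₁ (EB i j) = refl
rename-∘ ρ₂ σ₂ ρ₁ σ₁ (F i j)  = refl
rename-∘ ρ₂ σ₂ ρ₁ σ₁ (G i j)  = refl

rename-commute : {ρ₁ : Fin m → Fin k} {ρ₂ : Fin k → Fin m'}
                 {ρ₁' : Fin m → Fin k'} {ρ₂' : Fin k' → Fin m'}
                 {σ₁ : Fin n → Fin l} {σ₂ : Fin l → Fin n'}
                 {σ₁' : Fin n → Fin l'} {σ₂' : Fin l' → Fin n'} →
                 ρ₂ ∘ ρ₁ ≗ ρ₂' ∘ ρ₁' → σ₂ ∘ σ₁ ≗ σ₂' ∘ σ₁' →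
                 rename ρ₂ σ₂ ∘ rename ρ₁ σ₁ ≗ rename ρ₂' σ₂' ∘ rename ρ₁' σ₁'
rename-commute {ρ₁ = ρ₁} {ρ₂} {ρ₁'} {ρ₂'} {σ₁} {σ₂} {σ₁'} {σ₂'} e f φ =
  trans (rename-∘ ρ₂ σ₂ ρ₁ σ₁ φ)
        (trans (rename-cong e f φ) (sym (rename-∘ ρ₂' σ₂' ρ₁' σ₁' φ)))

rename-id : {ρ : Fin m → Fin m} {σ : Fin n → Fin n} → ρ ≗ idF → σ ≗ idF → ∀ φ →
            rename ρ σ φ ≡ φ
rename-id e f ⊥'       = refl
rename-id e f (φ ⇒ ψ)  = cong₂ _⇒_ (rename-id e f φ) (rename-id e f ψ)
rename-id e f (∀o φ)   = cong ∀o (rename-id (ext-id e) f φ)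
rename-id e f (∀c φ)   = cong ∀c (rename-id e (ext-id f) φ)
rename-id e f (i ≐o j) = cong₂ _≐o_ (e i) (e j)
rename-id e f (X ≐c Y) = cong₂ _≐c_ (f X) (f Y)
rename-id e f (i ∈' X) = cong₂ _∈'_ (e i) (f X)
rename-id e f (A' i)   = cong A' (e i)
rename-id e f (B' i)   = cong B' (e i)
rename-id e f (EA i j) = cong₂ EA (e i) (e j)
rename-id e f (EB i j) = cong₂ EB (e i) (e j)
rename-id e f (F i j)  = cong₂ F (e i) (e j)
rename-id e f (G i j)  = cong₂ G (e i) (e j)

rename-fromClosed : (ρ : Fin m → Fin m') (σ : Fin n → Fin n') (φ : Formula 0 0) →
                    rename ρ σ (fromClosed φ) ≡ fromClosed φ
rename-fromClosed ρ σ φ =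
  trans (rename-∘ ρ σ (λ ()) (λ ()) φ) (rename-cong (λ ()) (λ ()) φ)

rename-wkO : (ρ : Fin m → Fin m') (σ : Fin n → Fin n') →
             rename (ext ρ) σ ∘ wkO ≗ wkO ∘ rename ρ σ
rename-wkO ρ σ = rename-commute (λ _ → refl) (λ _ → refl)

rename-wkC : (ρ : Fin m → Fin m') (σ : Fin n → Fin n') →
             rename ρ (ext σ) ∘ wkC ≗ wkC ∘ rename ρ σ
rename-wkC ρ σ = rename-commute (λ _ → refl) (λ _ → refl)

rename-substO : (ρ : Fin m → Fin m') (σ : Fin n → Fin n') (i : Fin m) →
                rename ρ σ ∘ substO i ≗ substO (ρ i) ∘ rename (ext ρ) σ
rename-substO ρ σ i = rename-commute (λ { zero → refl ; (suc j) → refl }) (λ _ → refl)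

rename-substC : (ρ : Fin m → Fin m') (σ : Fin n → Fin n') (X : Fin n) →
                rename ρ σ ∘ substC X ≗ substC (σ X) ∘ rename ρ (ext σ)
rename-substC ρ σ X = rename-commute (λ _ → refl) (λ { zero → refl ; (suc j) → refl })

wkO₁ : Formula (suc m) n → Formula (suc (suc m)) n
wkO₁ = rename (ext suc) idF

substO-zero-wkO₁ : (φ : Formula (suc m) n) → substO zero (wkO₁ φ) ≡ φ
substO-zero-wkO₁ φ = trans (rename-∘ (inst zero) idF (ext suc) idF φ)
                           (rename-id (λ { zero → refl ; (suc i) → refl }) (λ _ → refl) φ)

substO-suc-wkO₁ : (i : Fin m) → substO (suc i) ∘ wkO₁ {n = n} ≗ wkO ∘ substO i
substO-suc-wkO₁ i = rename-commute (λ { zero → refl ; (suc j) → refl }) (λ _ → refl)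

map-commute : ∀ {A B B' C : Set} {f : A → B} {g : B → C} {f' : A → B'} {g' : B' → C} →
              g ∘ f ≗ g' ∘ f' → map g ∘ map f ≗ map g' ∘ map f'
map-commute e xs = trans (sym (map-∘ xs)) (trans (map-cong e xs) (map-∘ xs))

weaken : Γ ⊆ Δ → T ∣ Γ ⊢ φ → T ∣ Δ ⊢ φ
weaken Γ⊆Δ (ax a)      = ax a
weaken Γ⊆Δ (hyp p)     = hyp (Γ⊆Δ p)
weaken Γ⊆Δ (⇒I d)      = ⇒I (weaken (∷⁺ʳ _ Γ⊆Δ) d)
weaken Γ⊆Δ (⇒E d e)    = ⇒E (weaken Γ⊆Δ d) (weaken Γ⊆Δ e)
weaken Γ⊆Δ (raa d)     = raa (weaken (∷⁺ʳ _ Γ⊆Δ) d)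
weaken Γ⊆Δ (∀oI d)     = ∀oI (weaken (map⁺ wkO Γ⊆Δ) d)
weaken Γ⊆Δ (∀oE d i)   = ∀oE (weaken Γ⊆Δ d) i
weaken Γ⊆Δ (∀cI d)     = ∀cI (weaken (map⁺ wkC Γ⊆Δ) d)
weaken Γ⊆Δ (∀cE d X)   = ∀cE (weaken Γ⊆Δ d) X
weaken Γ⊆Δ (reflO i)   = reflO i
weaken Γ⊆Δ (eqO φ d e) = eqO φ (weaken Γ⊆Δ d) (weaken Γ⊆Δ e)
weaken Γ⊆Δ (reflC X)   = reflC X
weaken Γ⊆Δ (eqC φ d e) = eqC φ (weaken Γ⊆Δ d) (weaken Γ⊆Δ e)

cast : φ ≡ ψ → T ∣ Γ ⊢ φ → T ∣ Γ ⊢ ψ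
cast {T = T} {Γ = Γ} = subst (T ∣ Γ ⊢_)

cast-ctx : Γ ≡ Δ → T ∣ Γ ⊢ φ → T ∣ Δ ⊢ φ
cast-ctx {T = T} {φ = φ} = subst (T ∣_⊢ φ)

⊢-rename : (ρ : Fin m → Fin m') (σ : Fin n → Fin n') →
           T ∣ Γ ⊢ φ → T ∣ map (rename ρ σ) Γ ⊢ rename ρ σ φ
⊢-rename ρ σ (ax {φ = φ} a) = cast (sym (rename-fromClosed ρ σ φ)) (ax a)
⊢-rename ρ σ (hyp p)        = hyp (∈-map⁺ _ p)
⊢-rename ρ σ (⇒I d)         = ⇒I (⊢-rename ρ σ d)
⊢-rename ρ σ (⇒E d e)       = ⇒E (⊢-rename ρ σ d) (⊢-rename ρ σ e)
⊢-rename ρ σ (raa d)        = raa (⊢-rename ρ σ d)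
⊢-rename {Γ = Γ} ρ σ (∀oI d) =
  ∀oI (cast-ctx (map-commute (rename-wkO ρ σ) Γ) (⊢-rename (ext ρ) σ d))
⊢-rename ρ σ (∀oE {φ = φ} d i) =
  cast (sym (rename-substO ρ σ i φ)) (∀oE (⊢-rename ρ σ d) (ρ i))
⊢-rename {Γ = Γ} ρ σ (∀cI d) =
  ∀cI (cast-ctx (map-commute (rename-wkC ρ σ) Γ) (⊢-rename ρ (ext σ) d))
⊢-rename ρ σ (∀cE {φ = φ} d X) =
  cast (sym (rename-substC ρ σ X φ)) (∀cE (⊢-rename ρ σ d) (σ X))
⊢-rename ρ σ (reflO i)      = reflO (ρ i)
⊢-rename ρ σ (eqO {i = i} {j} φ d e) =
  cast (sym (rename-substO ρ σ j φ))
       (eqO (rename (ext ρ) σ φ) (⊢-rename ρ σ d) (cast (rename-substO ρ σ i φ) (⊢-rename ρ σ e)))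
⊢-rename ρ σ (reflC X)      = reflC (σ X)
⊢-rename ρ σ (eqC {X = X} {Y} φ d e) =
  cast (sym (rename-substC ρ σ Y φ))
       (eqC (rename ρ (ext σ) φ) (⊢-rename ρ σ d) (cast (rename-substC ρ σ X φ) (⊢-rename ρ σ e)))

private variable
  x x' y y' z : Fin m
  X Y : Fin n

hyp₀ : T ∣ φ ∷ Γ ⊢ φ
hyp₀ = hyp (here refl)

hyp₁ : T ∣ ψ ∷ φ ∷ Γ ⊢ φ
hyp₁ = hyp (there (here refl))

wk1 : T ∣ Γ ⊢ φ → T ∣ ψ ∷ Γ ⊢ φ
wk1 = weaken there

wk2 : T ∣ φ ∷ Γ ⊢ χ → T ∣ φ ∷ ψ ∷ Γ ⊢ χ
wk2 = weaken (∷⁺ʳ _ there)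

↑o : T ∣ Γ ⊢ φ → T ∣ ψ ∷ map wkO Γ ⊢ wkO φ
↑o d = wk1 (⊢-rename suc idF d)

↑c : T ∣ Γ ⊢ φ → T ∣ ψ ∷ map wkC Γ ⊢ wkC φ
↑c d = wk1 (⊢-rename idF suc d)

↑c² : T ∣ Γ ⊢ φ → T ∣ ψ ∷ χ ∷ map wkC (map wkC Γ) ⊢ wkC (wkC φ)
↑c² d = wk1 (wk1 (⊢-rename idF suc (⊢-rename idF suc d)))

cut : T ∣ Γ ⊢ φ → T ∣ φ ∷ Γ ⊢ ψ → T ∣ Γ ⊢ ψ
cut d k = ⇒E (⇒I k) d

⊥E : T ∣ Γ ⊢ ⊥' → T ∣ Γ ⊢ φ
⊥E d = raa (wk1 d)

contradiction : T ∣ Γ ⊢ φ → T ∣ Γ ⊢ ¬' φ → T ∣ Γ ⊢ ψ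
contradiction a b = ⊥E (⇒E b a)

∧I : T ∣ Γ ⊢ φ → T ∣ Γ ⊢ ψ → T ∣ Γ ⊢ φ ∧' ψ
∧I a b = ⇒I (⇒E (⇒E hyp₀ (wk1 a)) (wk1 b))

∧E₁ : T ∣ Γ ⊢ φ ∧' ψ → T ∣ Γ ⊢ φ
∧E₁ d = raa (⇒E (wk1 d) (⇒I (⇒I (⇒E (hyp (there (there (here refl)))) hyp₁))))

∧E₂ : T ∣ Γ ⊢ φ ∧' ψ → T ∣ Γ ⊢ ψ
∧E₂ d = raa (⇒E (wk1 d) (⇒I hyp₁))

∨I₁ : T ∣ Γ ⊢ φ → T ∣ Γ ⊢ φ ∨' ψ
∨I₁ a = ⇒I (contradiction (wk1 a) hyp₀)

∨I₂ : T ∣ Γ ⊢ ψ → T ∣ Γ ⊢ φ ∨' ψ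
∨I₂ b = ⇒I (wk1 b)

by-cases : (φ : Formula m n) → T ∣ φ ∷ Γ ⊢ χ → T ∣ ¬' φ ∷ Γ ⊢ χ → T ∣ Γ ⊢ χ
by-cases φ k₁ k₂ = raa (⇒E hyp₀ (cut (⇒I (⇒E hyp₁ (wk2 k₁))) (wk2 k₂)))

∨E : T ∣ Γ ⊢ φ ∨' ψ → T ∣ φ ∷ Γ ⊢ χ → T ∣ ψ ∷ Γ ⊢ χ → T ∣ Γ ⊢ χ
∨E {φ = φ} d k₁ k₂ = by-cases φ k₁ (cut (⇒E (wk1 d) hyp₀) (wk2 k₂))

⇔E₁ : T ∣ Γ ⊢ φ ⇔' ψ → T ∣ Γ ⊢ φ → T ∣ Γ ⊢ ψ
⇔E₁ d a = ⇒E (∧E₁ d) a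

⇔E₂ : T ∣ Γ ⊢ φ ⇔' ψ → T ∣ Γ ⊢ ψ → T ∣ Γ ⊢ φ
⇔E₂ d b = ⇒E (∧E₂ d) b

∃oI : (i : Fin m) → T ∣ Γ ⊢ substO i φ → T ∣ Γ ⊢ ∃o φ
∃oI i d = ⇒I (⇒E (∀oE hyp₀ i) (wk1 d))

∃oE : T ∣ Γ ⊢ ∃o φ → T ∣ φ ∷ map wkO Γ ⊢ wkO ψ → T ∣ Γ ⊢ ψ
∃oE d k = raa (⇒E (wk1 d) (∀oI (⇒I (⇒E hyp₁ (wk2 k)))))

∃cI : (X : Fin n) → T ∣ Γ ⊢ substC X φ → T ∣ Γ ⊢ ∃c φ
∃cI X d = ⇒I (⇒E (∀cE hyp₀ X) (wk1 d))

∃cE : T ∣ Γ ⊢ ∃c φ → T ∣ φ ∷ map wkC Γ ⊢ wkC ψ → T ∣ Γ ⊢ ψ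
∃cE d k = raa (⇒E (wk1 d) (∀cI (⇒I (⇒E hyp₁ (wk2 k)))))

symO : T ∣ Γ ⊢ x ≐o y → T ∣ Γ ⊢ y ≐o x
symO {x = x} d = eqO (zero ≐o suc x) d (reflO x)

EA-refl : SB ∣ Γ ⊢ A' x → SB ∣ Γ ⊢ EA x x
EA-refl a = ⇒E (∀oE (ax (EAeq refl')) _) a

EA-sym : SB ∣ Γ ⊢ EA x y → SB ∣ Γ ⊢ EA y x
EA-sym e = ⇒E (∀oE (∀oE (ax (EAeq sym')) _) _) e

EA-trans : SB ∣ Γ ⊢ EA x y → SB ∣ Γ ⊢ EA y z → SB ∣ Γ ⊢ EA x z
EA-trans e e' = ⇒E (∀oE (∀oE (∀oE (ax (EAeq trans')) _) _) _) (∧I e e')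

EB-refl : SB ∣ Γ ⊢ B' y → SB ∣ Γ ⊢ EB y y
EB-refl b = ⇒E (∀oE (ax (EBeq refl')) _) b

EB-sym : SB ∣ Γ ⊢ EB x y → SB ∣ Γ ⊢ EB y x
EB-sym e = ⇒E (∀oE (∀oE (ax (EBeq sym')) _) _) e

F-dom : SB ∣ Γ ⊢ F x y → SB ∣ Γ ⊢ A' x ∧' B' y
F-dom f = ⇒E (∀oE (∀oE (ax (Finj dom)) _) _) f

F-resp : SB ∣ Γ ⊢ EA x x' → SB ∣ Γ ⊢ F x' y' → SB ∣ Γ ⊢ EB y' y → SB ∣ Γ ⊢ F x y
F-resp e f e' =
  ⇒E (∀oE (∀oE (∀oE (∀oE (ax (Finj resp)) _) _) _) _) (∧I e (∧I f e'))

F-total : SB ∣ Γ ⊢ A' x → SB ∣ Γ ⊢ ∃o (F (suc x) zero)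
F-total a = ⇒E (∀oE (ax (Finj total)) _) a

F-func : SB ∣ Γ ⊢ F x y → SB ∣ Γ ⊢ F x y' → SB ∣ Γ ⊢ EB y y'
F-func f f' = ⇒E (∀oE (∀oE (∀oE (ax (Finj func)) _) _) _) (∧I f f')

F-inj : SB ∣ Γ ⊢ F x y → SB ∣ Γ ⊢ F x' y → SB ∣ Γ ⊢ EA x x'
F-inj f f' = ⇒E (∀oE (∀oE (∀oE (ax (Finj inj)) _) _) _) (∧I f f')

G-dom : SB ∣ Γ ⊢ G y x → SB ∣ Γ ⊢ B' y ∧' A' x
G-dom g = ⇒E (∀oE (∀oE (ax (Ginj dom)) _) _) g

G-resp : SB ∣ Γ ⊢ EB y y' → SB ∣ Γ ⊢ G y' x' → SB ∣ Γ ⊢ EA x' x → SB ∣ Γ ⊢ G y x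
G-resp e g e' =
  ⇒E (∀oE (∀oE (∀oE (∀oE (ax (Ginj resp)) _) _) _) _) (∧I e (∧I g e'))

G-total : SB ∣ Γ ⊢ B' y → SB ∣ Γ ⊢ ∃o (G (suc y) zero)
G-total b = ⇒E (∀oE (ax (Ginj total)) _) b

G-func : SB ∣ Γ ⊢ G y x → SB ∣ Γ ⊢ G y x' → SB ∣ Γ ⊢ EA x x'
G-func g g' = ⇒E (∀oE (∀oE (∀oE (ax (Ginj func)) _) _) _) (∧I g g')

G-inj : SB ∣ Γ ⊢ G y x → SB ∣ Γ ⊢ G y' x → SB ∣ Γ ⊢ EB y y'
G-inj g g' = ⇒E (∀oE (∀oE (∀oE (ax (Ginj inj)) _) _) _) (∧I g g')

F-respˡ : SB ∣ Γ ⊢ EA x x' → SB ∣ Γ ⊢ F x' y → SB ∣ Γ ⊢ F x y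
F-respˡ e f = F-resp e f (EB-refl (∧E₂ (F-dom f)))

F-respʳ : SB ∣ Γ ⊢ F x y' → SB ∣ Γ ⊢ EB y' y → SB ∣ Γ ⊢ F x y
F-respʳ f e = F-resp (EA-refl (∧E₁ (F-dom f))) f e

G-respʳ : SB ∣ Γ ⊢ G y x' → SB ∣ Γ ⊢ EA x' x → SB ∣ Γ ⊢ G y x
G-respʳ g e = G-resp (EB-refl (∧E₁ (G-dom g))) g e

∀∈ ∃∈ : Fin n → Formula (suc m) n → Formula m n
∀∈ X P = ∀o (zero ∈' X ⇒ P)
∃∈ X P = ∃o (zero ∈' X ∧' P)

private variable
  P : Formula (suc m) n

∀∈I : T ∣ (zero ∈' X) ∷ map wkO Γ ⊢ P → T ∣ Γ ⊢ ∀∈ X P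
∀∈I d = ∀oI (⇒I d)

∀∈E : T ∣ Γ ⊢ ∀∈ X P → T ∣ Γ ⊢ x ∈' X → T ∣ Γ ⊢ substO x P
∀∈E d m = ⇒E (∀oE d _) m

∀∈E₀ : T ∣ Γ ⊢ ∀∈ X P → T ∣ (zero ∈' X) ∷ map wkO Γ ⊢ P
∀∈E₀ {P = P} d = cast (substO-zero-wkO₁ P) (∀∈E (↑o d) hyp₀)

∃∈I : T ∣ Γ ⊢ x ∈' X → T ∣ Γ ⊢ substO x P → T ∣ Γ ⊢ ∃∈ X P
∃∈I m p = ∃oI _ (∧I m p)

∃∈I₀ : T ∣ Γ ⊢ zero ∈' X → T ∣ Γ ⊢ P → T ∣ Γ ⊢ ∃∈ X (wkO₁ P)
∃∈I₀ {P = P} m p = ∃∈I m (cast (sym (substO-zero-wkO₁ P)) p)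

∃∈E : T ∣ Γ ⊢ ∃∈ X P → T ∣ P ∷ (zero ∈' X) ∷ map wkO Γ ⊢ wkO ψ → T ∣ Γ ⊢ ψ
∃∈E d k = ∃oE d (cut (∧E₁ hyp₀) (cut (∧E₂ hyp₁) (weaken (∷⁺ʳ _ (∷⁺ʳ _ there)) k)))

∃∈-map : T ∣ Γ ⊢ ∃∈ X P → T ∣ P ∷ map wkO Γ ⊢ ψ → T ∣ Γ ⊢ ∃∈ X ψ
∃∈-map d k = ∃∈E d (∃∈I₀ hyp₁ (wk2 k))

Empty : Fin n → Formula m n
Empty X = ∀o (¬' (zero ∈' X))

Adjoin : Fin n → Fin n → Fin m → Formula m n
Adjoin X Y y = ∀o ((zero ∈' X) ⇔' ((zero ∈' Y) ∨' (zero ≐o suc y)))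

∃-Empty : SB ∣ Γ ⊢ ∃c (Empty zero)
∃-Empty = ax (ac empty)

∃-Adjoin : (Y : Fin n) (y : Fin m) → SB ∣ Γ ⊢ ∃c (Adjoin zero (suc Y) y)
∃-Adjoin Y y = ∀oE (∀cE (ax (ac adjunction)) Y) y

Empty-∉ : T ∣ Γ ⊢ Empty X → T ∣ Γ ⊢ x ∈' X → T ∣ Γ ⊢ ψ
Empty-∉ e m = contradiction m (∀oE e _)

Empty-∀∈ : T ∣ Γ ⊢ Empty X → T ∣ Γ ⊢ ∀∈ X P
Empty-∀∈ e = ∀∈I (Empty-∉ (↑o e) hyp₀)

Adjoin-new : T ∣ Γ ⊢ Adjoin X Y y → T ∣ Γ ⊢ y ∈' X
Adjoin-new s = ⇔E₂ (∀oE s _) (∨I₂ (reflO _))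

Adjoin-old : T ∣ Γ ⊢ Adjoin X Y y → T ∣ Γ ⊢ x ∈' Y → T ∣ Γ ⊢ x ∈' X
Adjoin-old s m = ⇔E₂ (∀oE s _) (∨I₁ m)

Adjoin-cases : T ∣ Γ ⊢ Adjoin X Y y → T ∣ Γ ⊢ x ∈' X → T ∣ Γ ⊢ (x ∈' Y) ∨' (x ≐o y)
Adjoin-cases s m = ⇔E₁ (∀oE s _) m

Adjoin-∀∈ : T ∣ Γ ⊢ Adjoin X Y y →
            T ∣ (zero ∈' Y) ∷ map wkO Γ ⊢ P → T ∣ Γ ⊢ substO y P → T ∣ Γ ⊢ ∀∈ X P
Adjoin-∀∈ {T = T} {Γ = Γ} {X = X} {y = y} {P = P} s old new =
  ∀∈I (∨E (Adjoin-cases (↑o s) hyp₀) (wk2 old) new₀)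
  where
  new₀ : T ∣ (zero ≐o suc y) ∷ (zero ∈' X) ∷ map wkO Γ ⊢ P
  new₀ = cast (substO-zero-wkO₁ P)
           (eqO (wkO₁ P) (symO hyp₀) (cast (sym (substO-suc-wkO₁ y P)) (wk1 (↑o new))))

Adjoin-∃∈ : T ∣ Γ ⊢ Adjoin X Y y → T ∣ Γ ⊢ ∃∈ Y P → T ∣ Γ ⊢ ∃∈ X P
Adjoin-∃∈ s d = ∃∈E d (∃∈I₀ (Adjoin-old (wk1 (↑o s)) hyp₁) hyp₀)

MemberUpToEA : Fin m → Fin n → Formula m n
MemberUpToEA x X = ∃∈ X (EA zero (suc x))

AncestorClosed : Fin n → Fin n → Formula m n
AncestorClosed XA XB =
  ∀∈ XA (¬' (∃o (G zero (suc zero))) ∨' ∃∈ XB (G zero (suc zero))) ∧'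
  ∀∈ XB (∃∈ XA (F zero (suc zero)))

Anchored : Fin m → Formula m n
Anchored x = ∃c (∃c (MemberUpToEA x (suc zero) ∧' AncestorClosed (suc zero) zero))

Anchored-intro : {XA XB : Fin n} →
  T ∣ Γ ⊢ MemberUpToEA x XA → T ∣ Γ ⊢ AncestorClosed XA XB → T ∣ Γ ⊢ Anchored x
Anchored-intro {XA = XA} {XB} m c = ∃cI XA (∃cI XB (∧I m c))

Anchored-elim : T ∣ Γ ⊢ Anchored x →
  T ∣ AncestorClosed (suc zero) zero ∷ MemberUpToEA x (suc zero) ∷ map wkC (map wkC Γ)
    ⊢ wkC (wkC ψ) →
  T ∣ Γ ⊢ ψ
Anchored-elim d k =
  ∃cE d (∃cE hyp₀ (cut (∧E₁ hyp₀) (cut (∧E₂ hyp₁)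
    (weaken (∷⁺ʳ _ (∷⁺ʳ _ (there ∘ there))) k))))

MemberUpToEA-resp : SB ∣ Γ ⊢ EA x x' →
                    SB ∣ Γ ⊢ MemberUpToEA x' X → SB ∣ Γ ⊢ MemberUpToEA x X
MemberUpToEA-resp e m = ∃∈E m (∃∈I hyp₁ (EA-trans hyp₀ (EA-sym (wk1 (↑o e)))))

Anchored-resp : SB ∣ Γ ⊢ EA x x' → SB ∣ Γ ⊢ Anchored {n = n} x' → SB ∣ Γ ⊢ Anchored x
Anchored-resp e d = Anchored-elim d (Anchored-intro (MemberUpToEA-resp (↑c² e) hyp₁) hyp₀)

Anchored-∉ran-G : SB ∣ Γ ⊢ A' x → SB ∣ Γ ⊢ ¬' (∃o (G zero (suc x))) →
                  SB ∣ Γ ⊢ Anchored {n = n} x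
Anchored-∉ran-G {x = x} a ng =
  ∃cE ∃-Empty (∃cE (∃-Adjoin zero x)
    (Anchored-intro {XA = zero} {XB = suc zero}
      (∃∈I (Adjoin-new hyp₀) (EA-refl (↑c (↑c a))))
      (∧I (Adjoin-∀∈ hyp₀ (Empty-∉ (↑o hyp₁) hyp₀) (∨I₁ (↑c (↑c ng))))
          (Empty-∀∈ hyp₁))))

AncestorClosed-adjoin : {XA XB XA' XB' : Fin n} →
  SB ∣ Γ ⊢ MemberUpToEA x XA → SB ∣ Γ ⊢ AncestorClosed XA XB →
  SB ∣ Γ ⊢ Adjoin XA' XA x' → SB ∣ Γ ⊢ Adjoin XB' XB y →
  SB ∣ Γ ⊢ F x y → SB ∣ Γ ⊢ G y x' → SB ∣ Γ ⊢ AncestorClosed XA' XB'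
AncestorClosed-adjoin m c sA sB f g =
  ∧I (Adjoin-∀∈ sA
        (∨E (∀∈E₀ (∧E₁ c)) (∨I₁ hyp₀) (∨I₂ (Adjoin-∃∈ (wk1 (↑o sB)) hyp₀)))
        (∨I₂ (∃∈I (Adjoin-new sB) g)))
     (Adjoin-∀∈ sB
        (Adjoin-∃∈ (↑o sA) (∀∈E₀ (∧E₂ c)))
        (∃∈E m (∃∈I (Adjoin-old (wk1 (↑o sA)) hyp₁) (F-respˡ hyp₀ (wk1 (↑o f))))))

Anchored-adjoin : {XA XB XA' XB' : Fin n} →
  SB ∣ Γ ⊢ MemberUpToEA x XA → SB ∣ Γ ⊢ AncestorClosed XA XB →
  SB ∣ Γ ⊢ Adjoin XA' XA x' → SB ∣ Γ ⊢ Adjoin XB' XB y →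
  SB ∣ Γ ⊢ F x y → SB ∣ Γ ⊢ G y x' → SB ∣ Γ ⊢ Anchored x'
Anchored-adjoin m c sA sB f g =
  Anchored-intro (∃∈I (Adjoin-new sA) (EA-refl (∧E₂ (G-dom g))))
                 (AncestorClosed-adjoin m c sA sB f g)

Anchored-step : SB ∣ Γ ⊢ Anchored {n = n} x → SB ∣ Γ ⊢ F x y → SB ∣ Γ ⊢ G y x' →
                SB ∣ Γ ⊢ Anchored x'
Anchored-step {y = y} {x' = x'} d f g =
  -- the class index suc zero denotes XA in the first adjunction and XB in the second
  Anchored-elim d (∃cE (∃-Adjoin (suc zero) x') (∃cE (∃-Adjoin (suc zero) y)
    (Anchored-adjoin (↑c (↑c hyp₁)) (↑c (↑c hyp₀)) hyp₁ hyp₀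
                     (↑c (↑c (↑c² f))) (↑c (↑c (↑c² g))))))

AncestorClosed-G⁻¹ : {XA XB : Fin n} →
  SB ∣ Γ ⊢ MemberUpToEA x XA → SB ∣ Γ ⊢ AncestorClosed XA XB → SB ∣ Γ ⊢ G y x →
  SB ∣ Γ ⊢ ∃∈ XB (EB zero (suc y))
AncestorClosed-G⁻¹ {y = y} m c g =
  ∃∈E m (cut (G-respʳ (wk1 (↑o g)) (EA-sym hyp₀))
    (∨E (wk1 (wk1 (∀∈E₀ (∧E₁ c))))
      (contradiction (∃oI (suc y) hyp₁) hyp₀)
      (∃∈-map hyp₀ (G-inj hyp₀ (↑o hyp₁)))))

AncestorClosed-F⁻¹ : {XA XB : Fin n} →
  SB ∣ Γ ⊢ AncestorClosed XA XB → SB ∣ Γ ⊢ ∃∈ XB (EB zero (suc y)) →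
  SB ∣ Γ ⊢ ∃∈ XA (F zero (suc y))
AncestorClosed-F⁻¹ c d = ∃∈E d (∃∈-map (wk1 (∀∈E₀ (∧E₂ c))) (F-respʳ hyp₀ (↑o hyp₀)))

Anchored-back : SB ∣ Γ ⊢ Anchored {n = n} x → SB ∣ Γ ⊢ G y x →
                SB ∣ Γ ⊢ ∃o (F zero (suc y) ∧' Anchored {n = n} zero)
Anchored-back d g =
  Anchored-elim d (∃∈E (AncestorClosed-F⁻¹ hyp₀ (AncestorClosed-G⁻¹ hyp₁ hyp₀ (↑c² g)))
    (∃oI zero (∧I hyp₀ (Anchored-intro (∃∈I hyp₁ (EA-refl (∧E₁ (F-dom hyp₀))))
                                       (wk1 (↑o hyp₀))))))

Hʳ : Rel₂
Hʳ x y = (F x y ∧' Anchored x) ∨' (G y x ∧' ¬' (Anchored x))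

H-dom : SB ∣ Γ ⊢ Hʳ x y → SB ∣ Γ ⊢ A' x ∧' B' y
H-dom h = ∨E h (F-dom (∧E₁ hyp₀))
                (∧I (∧E₂ (G-dom (∧E₁ hyp₀))) (∧E₁ (G-dom (∧E₁ hyp₀))))

H-resp : SB ∣ Γ ⊢ EA x x' → SB ∣ Γ ⊢ Hʳ x' y' → SB ∣ Γ ⊢ EB y' y → SB ∣ Γ ⊢ Hʳ x y
H-resp e h e' = ∨E h
  (∨I₁ (∧I (F-resp (wk1 e) (∧E₁ hyp₀) (wk1 e')) (Anchored-resp (wk1 e) (∧E₂ hyp₀))))
  (∨I₂ (∧I (G-resp (EB-sym (wk1 e')) (∧E₁ hyp₀) (EA-sym (wk1 e)))
           (⇒I (⇒E (∧E₂ hyp₁) (Anchored-resp (EA-sym (wk1 (wk1 e))) hyp₀)))))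

H-total : SB ∣ Γ ⊢ A' x → SB ∣ Γ ⊢ ∃o (Hʳ (suc x) zero)
H-total {x = x} a = by-cases (Anchored x)
  (∃oE (F-total (wk1 a)) (∃oI zero (∨I₁ (∧I hyp₀ (↑o hyp₀)))))
  (by-cases (∃o (G zero (suc x)))
    (∃oE hyp₀ (∃oI zero (∨I₂ (∧I hyp₀ (↑o hyp₁)))))
    (contradiction (Anchored-∉ran-G (wk1 (wk1 a)) hyp₀) hyp₁))

H-func : SB ∣ Γ ⊢ Hʳ x y → SB ∣ Γ ⊢ Hʳ x y' → SB ∣ Γ ⊢ EB y y'
H-func h h' = ∨E h
  (∨E (wk1 h') (F-func (∧E₁ hyp₁) (∧E₁ hyp₀)) (contradiction (∧E₂ hyp₁) (∧E₂ hyp₀)))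
  (∨E (wk1 h') (contradiction (∧E₂ hyp₀) (∧E₂ hyp₁)) (G-inj (∧E₁ hyp₁) (∧E₁ hyp₀)))

H-inj : SB ∣ Γ ⊢ Hʳ x y → SB ∣ Γ ⊢ Hʳ x' y → SB ∣ Γ ⊢ EA x x'
H-inj h h' = ∨E h
  (∨E (wk1 h') (F-inj (∧E₁ hyp₁) (∧E₁ hyp₀))
     (contradiction (Anchored-step (∧E₂ hyp₁) (∧E₁ hyp₁) (∧E₁ hyp₀)) (∧E₂ hyp₀)))
  (∨E (wk1 h')
     (contradiction (Anchored-step (∧E₂ hyp₀) (∧E₁ hyp₀) (∧E₁ hyp₁)) (∧E₂ hyp₁))
     (G-func (∧E₁ hyp₁) (∧E₁ hyp₀)))

H-surj : SB ∣ Γ ⊢ B' y → SB ∣ Γ ⊢ ∃o (Hʳ zero (suc y))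
H-surj b = ∃oE (G-total b)
  (by-cases (Anchored zero)
    (∃oE (Anchored-back hyp₀ hyp₁) (∃oI zero (∨I₁ hyp₀)))
    (∃oI zero (∨I₂ (∧I hyp₁ hyp₀))))

H-bijection : (φ : Formula 0 0) → BijAx Aᵖ Bᵖ EAʳ EBʳ (asRel (Hʳ zero (suc zero))) φ → SB ⊢ φ
H-bijection _ (injection dom)   = ∀oI (∀oI (⇒I (H-dom hyp₀)))
H-bijection _ (injection resp)  =
  ∀oI (∀oI (∀oI (∀oI (⇒I (H-resp (∧E₁ hyp₀) (∧E₁ (∧E₂ hyp₀)) (∧E₂ (∧E₂ hyp₀)))))))
H-bijection _ (injection total) = ∀oI (⇒I (H-total hyp₀))
H-bijection _ (injection func)  = ∀oI (∀oI (∀oI (⇒I (H-func (∧E₁ hyp₀) (∧E₂ hyp₀)))))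
H-bijection _ (injection inj)   = ∀oI (∀oI (∀oI (⇒I (H-inj (∧E₁ hyp₀) (∧E₂ hyp₀)))))
H-bijection _ surj              = ∀oI (⇒I (H-surj hyp₀))

theorem4p4 : Σ (Formula 2 0) (λ H → (φ : Formula 0 0) → BijAx Aᵖ Bᵖ EAʳ EBʳ (asRel H) φ → SB ⊢ φ)
theorem4p4 = Hʳ zero (suc zero) , H-bijection
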